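{- Let $q=2^n$ and let $A,B,C,D,E\in\mathbb{F}_{q^2}$ satisfy: $ACD\neq 0$, $A^{q+1}=1$, $D=AC^q$, $B^q=A^qB$, and $E^q=A^qE$. If $q$ is large enough, then $f_{A,B,C,D,E}(x)= x(Ax^2+Bx^q+Cx^{2q})+x^2(Dx^q+Ex^{2q})+x^{3q}$ is not APN on $\mathbb{F}_{q^2}$.
   Context: Here $q=2^n$, $\mathbb{F}_{q^2}$ is the finite field with $q^2$ elements, and for $A,B,C,D,E\in\mathbb{F}_{q^2}$ the function $f_{A,B,C,D,E}:\mathbb{F}_{q^2}\to\mathbb{F}_{q^2}$ is $f_{A,B,C,D,E}(x)=x(Ax^2+Bx^q+Cx^{2q})+x^2(Dx^q+Ex^{2q})+x^{3q}$. A function $f$ over $\mathbb{F}_{q^2}$ is APN (almost perfect nonlinear) if for every $a\neq 0$ and every $b$, the equation $f(x+a)+f(x)=b$ has at most two solutions $x\in\mathbb{F}_{q^2}$. -}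

module Defs where

open import Level using (0ℓ)
open import Data.Nat using (ℕ; zero; suc) renaming (_+_ to _+ℕ_; _*_ to _*ℕ_; _^_ to _^ℕ_)
open import Data.Fin using (Fin)
open import Data.Product using (∃)
open import Data.Sum using (_⊎_)
open import Relation.Binary.PropositionalEquality using (_≡_; _≢_)
open import Algebra.Structures using (IsCommutativeRing)
open import Function.Bundles using (_↔_)

record FiniteField (m : ℕ) : Set₁ where
  infixl 6 _+_
  infixl 7 _*_
  field
    Carrier : Set
    _+_ _*_ : Carrier → Carrier → Carrier
    -_ : Carrier → Carrier
    0# 1# : Carrier
    isCommutativeRing : IsCommutativeRing _≡_ _+_ _*_ -_ 0# 1#
    1≢0 : 1# ≢ 0#
    inverse : ∀ x → x ≢ 0# → ∃ λ y → x * y ≡ 1#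
    enumeration : Fin m ↔ Carrier

  _^_ : Carrier → ℕ → Carrier
  x ^ zero = 1#
  x ^ suc k = x * (x ^ k)

GF-q² : ℕ → Set₁
GF-q² n = FiniteField ((2 ^ℕ n) *ℕ (2 ^ℕ n))

module _ (n : ℕ) (F : GF-q² n) where
  open FiniteField F

  q : ℕ
  q = 2 ^ℕ n

  fABCDE : (A B C D E : Carrier) → Carrier → Carrier
  fABCDE A B C D E x =
    x * (A * (x ^ 2) + B * (x ^ q) + C * (x ^ (2 *ℕ q)))
    + (x ^ 2) * (D * (x ^ q) + E * (x ^ (2 *ℕ q)))
    + x ^ (3 *ℕ q)

  -- APN: for every a ≠ 0 and every b, f(x+a)+f(x)=b has at most two solutions
  -- (any three solutions contain a repeated one).
  IsAPN : (Carrier → Carrier) → Set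
  IsAPN f = ∀ a → a ≢ 0# → ∀ b → ∀ x y z →
    f (x + a) + f x ≡ b → f (y + a) + f y ≡ b → f (z + a) + f z ≡ b →
    x ≡ y ⊎ x ≡ z ⊎ y ≡ z

-- The field has even order, so its characteristic is 2 ((-1)^(q²-1) = 1 with q² - 1 odd) and
-- φ(x) = x^q is an involutive field automorphism. Writing f(x) = P(x, φ x) for a bivariate
-- polynomial P, the hypotheses on A, …, E give A·φ(f x) = f x, so f and every derivative
-- x ↦ f(x + a) + f(x) take values among the fixed points of y ↦ A·y^q. These are roots of
-- A y^q + y, hence at most q of them. A derivative of an APN function is at most 2-to-1, which
-- would force q² ≤ 2q; so f is not APN as soon as q > 2.
module Submission where

open import Level using (Level; _⊔_)
open import Defs
open import Data.Nat using (ℕ; zero; suc; _≥_; _<_; s≤s; z≤n)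
  renaming (_+_ to _+ℕ_; _*_ to _*ℕ_; _^_ to _^ℕ_; _≤_ to _≤ℕ_)
import Data.Nat.Properties as ℕ
open import Data.Nat.Divisibility using (_∣_; divides; m∣m*n; ∣m⇒∣m*n)
open import Data.Fin.Properties using (inj⇒≟)
open import Data.Product using (∃; _×_; _,_; proj₁; proj₂)
open import Data.Sum using (inj₁; inj₂)
open import Data.List using (List; []; _∷_; length; filter; map; foldr; tabulate)
import Data.List.Properties as List
open import Data.List.Relation.Unary.All using (All; []; _∷_)
import Data.List.Relation.Unary.All as All
open import Data.List.Relation.Unary.All.Properties using (all-filter)
open import Data.List.Relation.Unary.Any using (here; there)
open import Data.List.Relation.Unary.Unique.Propositional using (Unique; []; _∷_)
import Data.List.Relation.Unary.Unique.Propositional.Properties as Unique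
open import Data.List.Membership.Propositional using (_∈_)
open import Data.List.Membership.Propositional.Properties
  using (∈-filter⁺; ∈-filter⁻; ∈-map⁺; ∈-map⁻; ∈-tabulate⁺)
open import Data.List.Membership.Propositional.Properties.WithK using (unique∧set⇒bag)
open import Data.List.Relation.Binary.BagAndSetEquality using (∼bag⇒↭)
open import Data.List.Relation.Binary.Permutation.Propositional using (_↭_; ↭⇒↭ₛ)
import Data.List.Relation.Binary.Permutation.Setoid.Properties as PermutationProperties
open import Relation.Nullary using (¬_; yes; no; ¬?)
open import Relation.Nullary.Negation using (contradiction)
open import Relation.Unary using (Pred; Decidable)
open import Relation.Unary.Properties using (∁?)
open import Relation.Binary.Definitions using (DecidableEquality)
open import Relation.Binary.PropositionalEquality
open import Function using (_∘_; case_of_)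
open import Function.Bundles using (Inverse; Injection; mk⇔)
open import Function.Properties.Inverse using (↔-sym; ↔⇒↣)
open import Algebra.Bundles using (CommutativeRing)
open import Algebra.Structures using (IsCommutativeRing)
import Algebra.Properties.CommutativeSemiring.Exp
import Algebra.Properties.Group as GroupProperties
import Algebra.Properties.Ring as RingProperties

private
  variable
    a b p : Level

module _ {A : Set a} {P : Pred A p} (P? : Decidable P) where

  length-filter+filter-∁ : ∀ xs → length (filter P? xs) +ℕ length (filter (∁? P?) xs) ≡ length xs
  length-filter+filter-∁ [] = refl
  length-filter+filter-∁ (x ∷ xs) with P? x
  ... | yes _ = cong suc (length-filter+filter-∁ xs)
  ... | no _ = trans (ℕ.+-suc _ _) (cong suc (length-filter+filter-∁ xs))

module _ {A : Set a} (_≟_ : DecidableEquality A) where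

  ≢? : ∀ x → Decidable (_≢ x)
  ≢? x y = ¬? (y ≟ x)

  length-filter-≢ : ∀ {x xs} → Unique xs → x ∈ xs → length xs ≡ suc (length (filter (≢? x) xs))
  length-filter-≢ {x} (x∉ys ∷ _) (here refl) =
    cong suc (sym (cong length (trans (List.filter-reject (≢? x) (λ x≢x → x≢x refl))
      (List.filter-all (≢? x) (All.map ≢-sym x∉ys)))))
  length-filter-≢ {x} {y ∷ ys} (y∉ys ∷ ys-unique) (there x∈ys) =
    trans (cong suc (length-filter-≢ ys-unique x∈ys))
      (cong (suc ∘ length) (sym (List.filter-accept (≢? x) (All.lookup y∉ys x∈ys))))

FibresAtMost : {A : Set a} {B : Set b} → ℕ → (A → B) → Set (a ⊔ b)
FibresAtMost {A = A} k h = ∀ v (xs : List A) → Unique xs → All (λ x → h x ≡ v) xs → length xs ≤ℕ k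

module _ {A : Set a} {B : Set b} (_≟_ : DecidableEquality B) {h : A → B} {k : ℕ}
         (fibres≤k : FibresAtMost k h) where

  length≤k*length-image : ∀ (vs : List B) {xs : List A} → Unique xs →
    (∀ {x} → x ∈ xs → h x ∈ vs) → length xs ≤ℕ k *ℕ length vs
  length≤k*length-image [] {[]} _ _ = z≤n
  length≤k*length-image [] {x ∷ _} _ into with into (here refl)
  ... | ()
  length≤k*length-image (v ∷ vs) {xs} xs-unique into = begin
    length xs                                                ≡⟨ length-filter+filter-∁ hits xs ⟨
    length (filter hits xs) +ℕ length (filter (∁? hits) xs)  ≤⟨ ℕ.+-mono-≤ fibre rest ⟩
    k +ℕ k *ℕ length vs                                      ≡⟨ ℕ.*-suc k (length vs) ⟨
    k *ℕ length (v ∷ vs)                                     ∎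
    where
    open ℕ.≤-Reasoning
    hits : Decidable (λ x → h x ≡ v)
    hits x = h x ≟ v
    fibre : length (filter hits xs) ≤ℕ k
    fibre = fibres≤k v _ (Unique.filter⁺ hits xs-unique) (all-filter hits xs)
    rest : length (filter (∁? hits) xs) ≤ℕ k *ℕ length vs
    rest = length≤k*length-image vs (Unique.filter⁺ (∁? hits) xs-unique) λ x∈ →
      let (x∈xs , hx≢v) = ∈-filter⁻ (∁? hits) x∈ in
      case into x∈xs of λ where
        (here hx≡v) → contradiction hx≡v hx≢v
        (there hx∈vs) → hx∈vs

module FiniteFieldProperties {m : ℕ} (F : FiniteField m) where
  open FiniteField F
  open IsCommutativeRing isCommutativeRing
    using (+-assoc; +-identityˡ; +-identityʳ; -‿inverseʳ; *-assoc; *-comm;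
           *-identityˡ; *-identityʳ; zeroˡ; zeroʳ; distribˡ; distribʳ; *-isCommutativeMonoid)

  commutativeRing : CommutativeRing _ _
  commutativeRing = record { isCommutativeRing = isCommutativeRing }

  open CommutativeRing commutativeRing using (commutativeSemiring; ring; +-group)
  open import Algebra.Solver.Ring.NaturalCoefficients.Default commutativeSemiring
  private
    module Exp = Algebra.Properties.CommutativeSemiring.Exp commutativeSemiring

  ^≡Exp^ : ∀ x k → x ^ k ≡ x Exp.^ k
  ^≡Exp^ x zero = refl
  ^≡Exp^ x (suc k) = cong (x *_) (^≡Exp^ x k)

  ^-assocʳ : ∀ x i j → (x ^ i) ^ j ≡ x ^ (i *ℕ j)
  ^-assocʳ x i j
    rewrite ^≡Exp^ (x ^ i) j | ^≡Exp^ x i | ^≡Exp^ x (i *ℕ j) = Exp.^-assocʳ x i j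

  ^-distrib-* : ∀ x y k → (x * y) ^ k ≡ x ^ k * y ^ k
  ^-distrib-* x y k
    rewrite ^≡Exp^ (x * y) k | ^≡Exp^ x k | ^≡Exp^ y k = Exp.^-distrib-* x y k

  infix 4 _≟_
  _≟_ : DecidableEquality Carrier
  _≟_ = inj⇒≟ (↔⇒↣ (↔-sym enumeration))

  elements : List Carrier
  elements = tabulate (Inverse.to enumeration)

  elements-unique : Unique elements
  elements-unique = Unique.tabulate⁺ (Injection.injective (↔⇒↣ enumeration))

  ∈-elements : ∀ x → x ∈ elements
  ∈-elements x = subst (_∈ elements) (Inverse.strictlyInverseˡ enumeration x)
    (∈-tabulate⁺ (Inverse.from enumeration x))

  length-elements : length elements ≡ m
  length-elements = List.length-tabulate _

  *-inverse-cancel : ∀ {a b} → b * a ≡ 1# → ∀ x → b * (a * x) ≡ x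
  *-inverse-cancel {a} {b} ba≡1 x = begin
    b * (a * x)  ≡⟨ *-assoc b a x ⟨
    (b * a) * x  ≡⟨ cong (_* x) ba≡1 ⟩
    1# * x       ≡⟨ *-identityˡ x ⟩
    x            ∎
    where open ≡-Reasoning

  inverse-nonzero : ∀ {a b} → a * b ≡ 1# → b ≢ 0#
  inverse-nonzero {a} ab≡1 b≡0 = 1≢0 (trans (sym ab≡1) (trans (cong (a *_) b≡0) (zeroʳ a)))

  *-cancelˡ : ∀ {a x y} → a ≢ 0# → a * x ≡ a * y → x ≡ y
  *-cancelˡ {a} {x} {y} a≢0 ax≡ay with inverse a a≢0
  ... | b , ab≡1 = begin
    x            ≡⟨ *-inverse-cancel ba≡1 x ⟨
    b * (a * x)  ≡⟨ cong (b *_) ax≡ay ⟩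
    b * (a * y)  ≡⟨ *-inverse-cancel ba≡1 y ⟩
    y            ∎
    where
    open ≡-Reasoning
    ba≡1 : b * a ≡ 1#
    ba≡1 = trans (*-comm b a) ab≡1

  *-cancelʳ : ∀ {a x y} → a ≢ 0# → x * a ≡ y * a → x ≡ y
  *-cancelʳ {a} {x} {y} a≢0 xa≡ya = *-cancelˡ a≢0 (trans (*-comm a x) (trans xa≡ya (*-comm y a)))

  *-nonzero : ∀ {a b} → a ≢ 0# → b ≢ 0# → a * b ≢ 0#
  *-nonzero {a} a≢0 b≢0 ab≡0 = b≢0 (*-cancelˡ a≢0 (trans ab≡0 (sym (zeroʳ a))))

  *-nonzero⁻ˡ : ∀ {a b} → a * b ≢ 0# → a ≢ 0#
  *-nonzero⁻ˡ {b = b} ab≢0 a≡0 = ab≢0 (trans (cong (_* b) a≡0) (zeroˡ b))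

  product : List Carrier → Carrier
  product = foldr _*_ 1#

  product-map-* : ∀ a xs → product (map (a *_) xs) ≡ a ^ length xs * product xs
  product-map-* a [] = sym (*-identityˡ 1#)
  product-map-* a (x ∷ xs) = trans (cong ((a * x) *_) (product-map-* a xs))
    (solve 4 (λ a x b c → (a :* x) :* (b :* c) := (a :* b) :* (x :* c)) refl a x (a ^ length xs) (product xs))

  product-nonzero : ∀ {xs} → All (_≢ 0#) xs → product xs ≢ 0#
  product-nonzero [] = 1≢0
  product-nonzero (x≢0 ∷ xs≢0) = *-nonzero x≢0 (product-nonzero xs≢0)

  product-↭ : ∀ {xs ys} → xs ↭ ys → product xs ≡ product ys
  product-↭ xs↭ys = PermutationProperties.foldr-commMonoid (setoid Carrier) *-isCommutativeMonoid (↭⇒↭ₛ xs↭ys)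

  nonzero : List Carrier
  nonzero = filter (≢? _≟_ 0#) elements

  ∈-nonzero : ∀ {x} → x ≢ 0# → x ∈ nonzero
  ∈-nonzero x≢0 = ∈-filter⁺ (≢? _≟_ 0#) (∈-elements _) x≢0

  ∈-nonzero⁻ : ∀ {x} → x ∈ nonzero → x ≢ 0#
  ∈-nonzero⁻ x∈ = proj₂ (∈-filter⁻ (≢? _≟_ 0#) {xs = elements} x∈)

  nonzero-unique : Unique nonzero
  nonzero-unique = Unique.filter⁺ (≢? _≟_ 0#) elements-unique

  length-nonzero : m ≡ suc (length nonzero)
  length-nonzero = trans (sym length-elements) (length-filter-≢ _≟_ elements-unique (∈-elements 0#))

  map-*-nonzero-↭ : ∀ {a} → a ≢ 0# → map (a *_) nonzero ↭ nonzero
  map-*-nonzero-↭ {a} a≢0 = ∼bag⇒↭ (unique∧set⇒bag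
    (Unique.map⁺ (*-cancelˡ a≢0) nonzero-unique) nonzero-unique
    (mk⇔ from-map to-map))
    where
    from-map : ∀ {y} → y ∈ map (a *_) nonzero → y ∈ nonzero
    from-map y∈ with ∈-map⁻ (a *_) y∈
    ... | x , x∈ , refl = ∈-nonzero (*-nonzero a≢0 (∈-nonzero⁻ x∈))
    to-map : ∀ {y} → y ∈ nonzero → y ∈ map (a *_) nonzero
    to-map {y} y∈ with inverse a a≢0
    ... | b , ab≡1 = subst (_∈ map (a *_) nonzero) (*-inverse-cancel ab≡1 y)
      (∈-map⁺ (a *_) (∈-nonzero (*-nonzero (inverse-nonzero ab≡1) (∈-nonzero⁻ y∈))))

  fermat-nonzero : ∀ {a} → a ≢ 0# → a ^ length nonzero ≡ 1#
  fermat-nonzero {a} a≢0 = *-cancelˡ (product-nonzero nonzero≢0) (begin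
    product nonzero * a ^ length nonzero  ≡⟨ *-comm _ _ ⟩
    a ^ length nonzero * product nonzero  ≡⟨ product-map-* a nonzero ⟨
    product (map (a *_) nonzero)          ≡⟨ product-↭ (map-*-nonzero-↭ a≢0) ⟩
    product nonzero                       ≡⟨ *-identityʳ _ ⟨
    product nonzero * 1#                  ∎)
    where
    open ≡-Reasoning
    nonzero≢0 : All (_≢ 0#) nonzero
    nonzero≢0 = All.tabulate ∈-nonzero⁻

  fermat : ∀ a → a ^ m ≡ a
  fermat a with a ≟ 0#
  ... | yes refl = subst (λ k → 0# ^ k ≡ 0#) (sym length-nonzero) (zeroˡ _)
  ... | no a≢0 = begin
    a ^ m                       ≡⟨ cong (a ^_) length-nonzero ⟩
    a * a ^ length nonzero      ≡⟨ cong (a *_) (fermat-nonzero a≢0) ⟩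
    a * 1#                      ≡⟨ *-identityʳ a ⟩
    a                           ∎
    where open ≡-Reasoning

  x*x≡1⇒x^[1+2s]≡x : ∀ {x} → x * x ≡ 1# → ∀ s → x ^ suc (2 *ℕ s) ≡ x
  x*x≡1⇒x^[1+2s]≡x xx≡1 zero = *-identityʳ _
  x*x≡1⇒x^[1+2s]≡x {x} xx≡1 (suc s) = begin
    x ^ suc (2 *ℕ suc s)        ≡⟨ cong (λ k → x ^ suc k) (ℕ.*-suc 2 s) ⟩
    x * (x * x ^ suc (2 *ℕ s))  ≡⟨ cong (λ y → x * (x * y)) (x*x≡1⇒x^[1+2s]≡x xx≡1 s) ⟩
    x * (x * x)                 ≡⟨ cong (x *_) xx≡1 ⟩
    x * 1#                      ≡⟨ *-identityʳ x ⟩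
    x                           ∎
    where open ≡-Reasoning

  even-order⇒1+1≡0 : 2 ∣ m → 1# + 1# ≡ 0#
  even-order⇒1+1≡0 (divides r m≡r*2) = begin
    1# + 1#    ≡⟨ cong (1# +_) -1≡1 ⟨
    1# + - 1#  ≡⟨ -‿inverseʳ 1# ⟩
    0#         ∎
    where
    open ≡-Reasoning
    -1≢0 : - 1# ≢ 0#
    -1≢0 -1≡0 = 1≢0 (trans (sym (+-identityʳ 1#)) (trans (cong (1# +_) (sym -1≡0)) (-‿inverseʳ 1#)))
    -1*-1≡1 : - 1# * - 1# ≡ 1#
    -1*-1≡1 = trans (RingProperties.-1*x≈-x ring (- 1#)) (GroupProperties.⁻¹-involutive +-group 1#)
    odd : ∃ λ s → length nonzero ≡ suc (2 *ℕ s)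
    odd = half r (trans (sym length-nonzero) m≡r*2)
      where
      half : ∀ r → suc (length nonzero) ≡ r *ℕ 2 → ∃ λ s → length nonzero ≡ suc (2 *ℕ s)
      half (suc s) e = s , trans (ℕ.suc-injective e) (cong suc (ℕ.*-comm s 2))
    -1≡1 : - 1# ≡ 1#
    -1≡1 = begin
      - 1#                           ≡⟨ x*x≡1⇒x^[1+2s]≡x -1*-1≡1 (proj₁ odd) ⟨
      (- 1#) ^ suc (2 *ℕ proj₁ odd)  ≡⟨ cong ((- 1#) ^_) (proj₂ odd) ⟨
      (- 1#) ^ length nonzero        ≡⟨ fermat-nonzero -1≢0 ⟩
      1#                             ∎

  -- `PolynomialFunction d lc g`: g agrees pointwise with a polynomial of formal degree d in
  -- Horner form whose coefficient of x ^ d is lc.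
  data PolynomialFunction : ℕ → Carrier → (Carrier → Carrier) → Set where
    constant : ∀ {c g} → (∀ x → g x ≡ c) → PolynomialFunction 0 c g
    horner : ∀ {d lc g h} (c : Carrier) → PolynomialFunction d lc h →
             (∀ x → g x ≡ x * h x + c) → PolynomialFunction (suc d) lc g

  monomial : ∀ a k → PolynomialFunction k a (λ x → a * x ^ k)
  monomial a zero = constant (λ _ → *-identityʳ a)
  monomial a (suc k) = horner 0# (monomial a k) λ x →
    solve 3 (λ a x y → a :* (x :* y) := x :* (a :* y) :+ con 0) refl a x (x ^ k)

  +-lowerDegree : ∀ {d e a b g h} → PolynomialFunction d a g → PolynomialFunction e b h → e < d →
    PolynomialFunction d a (λ x → g x + h x)
  +-lowerDegree {b = b} (horner c p g≡) (constant h≡) _ = horner (c + b) p λ x →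
    trans (cong₂ _+_ (g≡ x) (h≡ x)) (+-assoc _ c b)
  +-lowerDegree (horner {h = g'} c p g≡) (horner {h = h'} c' q h≡) (s≤s e<d) =
    horner (c + c') (+-lowerDegree p q e<d) λ x →
      trans (cong₂ _+_ (g≡ x) (h≡ x))
        (solve 5 (λ x u v c c' → (x :* u :+ c) :+ (x :* v :+ c') := x :* (u :+ v) :+ (c :+ c'))
          refl x (g' x) (h' x) c c')

  -- Subtraction-free form of g(x) - g(r) = (x - r) k(x).
  factor-theorem : ∀ {d lc g} → PolynomialFunction (suc d) lc g → ∀ r →
    ∃ λ k → PolynomialFunction d lc k × (∀ x → g x + r * k x ≡ x * k x + g r)
  factor-theorem {lc = lc} {g} (horner {h = h} c (constant h≡) g≡) r =
    (λ _ → lc) , constant (λ _ → refl) , λ x → begin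
      g x + r * lc              ≡⟨ cong (_+ r * lc) (trans (g≡ x) (cong (λ y → x * y + c) (h≡ x))) ⟩
      x * lc + c + r * lc
        ≡⟨ solve 4 (λ x r l c → x :* l :+ c :+ r :* l := x :* l :+ (r :* l :+ c)) refl x r lc c ⟩
      x * lc + (r * lc + c)     ≡⟨ cong (λ y → x * lc + (r * y + c)) (h≡ r) ⟨
      x * lc + (r * h r + c)    ≡⟨ cong (x * lc +_) (g≡ r) ⟨
      x * lc + g r              ∎
    where open ≡-Reasoning
  factor-theorem {g = g} (horner {h = h} c p@(horner _ _ _) g≡) r with factor-theorem p r
  ... | k , k-poly , h-factored = (λ x → x * k x + h r) , horner (h r) k-poly (λ _ → refl) , λ x → begin
      g x + r * (x * k x + h r)           ≡⟨ cong (_+ r * (x * k x + h r)) (g≡ x) ⟩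
      x * h x + c + r * (x * k x + h r)
        ≡⟨ solve 6 (λ x r u v w c → x :* u :+ c :+ r :* (x :* v :+ w) := x :* (u :+ r :* v) :+ (r :* w :+ c))
             refl x r (h x) (k x) (h r) c ⟩
      x * (h x + r * k x) + (r * h r + c) ≡⟨ cong (λ y → x * y + (r * h r + c)) (h-factored x) ⟩
      x * (x * k x + h r) + (r * h r + c) ≡⟨ cong (x * (x * k x + h r) +_) (g≡ r) ⟨
      x * (x * k x + h r) + g r           ∎
    where open ≡-Reasoning

  roots≤degree : ∀ {d lc g} → PolynomialFunction d lc g → lc ≢ 0# →
    ∀ {rs} → Unique rs → All (λ x → g x ≡ 0#) rs → length rs ≤ℕ d
  roots≤degree _ _ {[]} _ _ = z≤n
  roots≤degree (constant g≡) lc≢0 {r ∷ _} _ (gr≡0 ∷ _) = contradiction (trans (sym (g≡ r)) gr≡0) lc≢0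
  roots≤degree {g = g} p@(horner _ _ _) lc≢0 {r ∷ rs} (r∉rs ∷ rs-unique) (gr≡0 ∷ rs-roots)
    with factor-theorem p r
  ... | k , k-poly , factored =
    s≤s (roots≤degree k-poly lc≢0 rs-unique (All.zipWith root-of-k (r∉rs , rs-roots)))
    where
    root-of-k : ∀ {y} → r ≢ y × g y ≡ 0# → k y ≡ 0#
    root-of-k {y} (r≢y , gy≡0) with k y ≟ 0#
    ... | yes ky≡0 = ky≡0
    ... | no ky≢0 = contradiction (*-cancelʳ ky≢0 (begin
      r * k y             ≡⟨ +-identityˡ _ ⟨
      0# + r * k y        ≡⟨ cong (_+ r * k y) gy≡0 ⟨
      g y + r * k y       ≡⟨ factored y ⟩
      y * k y + g r       ≡⟨ cong (y * k y +_) gr≡0 ⟩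
      y * k y + 0#        ≡⟨ +-identityʳ _ ⟩
      y * k y             ∎)) r≢y
      where open ≡-Reasoning

  module Characteristic2 (1+1≡0 : 1# + 1# ≡ 0#) where

    x+x≡0 : ∀ x → x + x ≡ 0#
    x+x≡0 x = begin
      x + x              ≡⟨ cong₂ _+_ (*-identityʳ x) (*-identityʳ x) ⟨
      x * 1# + x * 1#    ≡⟨ distribˡ x 1# 1# ⟨
      x * (1# + 1#)      ≡⟨ cong (x *_) 1+1≡0 ⟩
      x * 0#             ≡⟨ zeroʳ x ⟩
      0#                 ∎
      where open ≡-Reasoning

    square-homo-+ : ∀ x y → (x + y) ^ 2 ≡ x ^ 2 + y ^ 2
    square-homo-+ x y = begin
      (x + y) ^ 2
        ≡⟨ solve 2 (λ x y → (x :+ y) :^ 2 := x :^ 2 :+ y :^ 2 :+ (x :* y :+ x :* y)) refl x y ⟩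
      x ^ 2 + y ^ 2 + (x * y + x * y)  ≡⟨ cong (x ^ 2 + y ^ 2 +_) (x+x≡0 (x * y)) ⟩
      x ^ 2 + y ^ 2 + 0#               ≡⟨ +-identityʳ _ ⟩
      x ^ 2 + y ^ 2                    ∎
      where open ≡-Reasoning

    frobenius-+ : ∀ k x y → (x + y) ^ (2 ^ℕ k) ≡ x ^ (2 ^ℕ k) + y ^ (2 ^ℕ k)
    frobenius-+ zero x y = distribʳ 1# x y
    frobenius-+ (suc k) x y = begin
      (x + y) ^ (2 *ℕ 2 ^ℕ k)                  ≡⟨ ^-assocʳ (x + y) 2 (2 ^ℕ k) ⟨
      ((x + y) ^ 2) ^ (2 ^ℕ k)                 ≡⟨ cong (_^ (2 ^ℕ k)) (square-homo-+ x y) ⟩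
      (x ^ 2 + y ^ 2) ^ (2 ^ℕ k)               ≡⟨ frobenius-+ k (x ^ 2) (y ^ 2) ⟩
      (x ^ 2) ^ (2 ^ℕ k) + (y ^ 2) ^ (2 ^ℕ k)  ≡⟨ cong₂ _+_ (^-assocʳ x 2 (2 ^ℕ k)) (^-assocʳ y 2 (2 ^ℕ k)) ⟩
      x ^ (2 *ℕ 2 ^ℕ k) + y ^ (2 *ℕ 2 ^ℕ k)    ∎
      where open ≡-Reasoning

module _ (n : ℕ) (F : GF-q² n) where
  open FiniteField F

  APN⇒derivative-2-to-1 : ∀ {f} → IsAPN n F f → ∀ {a} → a ≢ 0# → FibresAtMost 2 (λ x → f (x + a) + f x)
  APN⇒derivative-2-to-1 apn a≢0 v [] _ _ = z≤n
  APN⇒derivative-2-to-1 apn a≢0 v (_ ∷ []) _ _ = s≤s z≤n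
  APN⇒derivative-2-to-1 apn a≢0 v (_ ∷ _ ∷ []) _ _ = s≤s (s≤s z≤n)
  APN⇒derivative-2-to-1 apn a≢0 v (x ∷ y ∷ z ∷ _)
    ((x≢y ∷ x≢z ∷ _) ∷ (y≢z ∷ _) ∷ _) (Δx ∷ Δy ∷ Δz ∷ _)
    with apn _ a≢0 v x y z Δx Δy Δz
  ... | inj₁ x≡y = contradiction x≡y x≢y
  ... | inj₂ (inj₁ x≡z) = contradiction x≡z x≢z
  ... | inj₂ (inj₂ y≡z) = contradiction y≡z y≢z

module TwistedFrobenius (n : ℕ) (F : GF-q² (suc n)) where
  open FiniteField F
  open FiniteFieldProperties F
  open IsCommutativeRing isCommutativeRing using (*-identityˡ; *-identityʳ; distribˡ)
  open import Algebra.Solver.Ring.NaturalCoefficients.Default (CommutativeRing.commutativeSemiring commutativeRing)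

  -- Q = 2 ^ (suc n) is the paper's q: this module's n is one less than the paper's, so Q is even.
  Q : ℕ
  Q = q (suc n) F

  open Characteristic2 (even-order⇒1+1≡0 (∣m⇒∣m*n Q (m∣m*n (2 ^ℕ n))))

  φ : Carrier → Carrier
  φ x = x ^ Q

  φ-+ : ∀ x y → φ (x + y) ≡ φ x + φ y
  φ-+ = frobenius-+ (suc n)

  φ-* : ∀ x y → φ (x * y) ≡ φ x * φ y
  φ-* x y = ^-distrib-* x y Q

  φ-^ : ∀ x k → φ (x ^ k) ≡ φ x ^ k
  φ-^ x k = trans (^-assocʳ x k Q) (trans (cong (x ^_) (ℕ.*-comm k Q)) (sym (^-assocʳ x Q k)))

  φ-involutive : ∀ x → φ (φ x) ≡ x
  φ-involutive x = trans (^-assocʳ x Q Q) (fermat x)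

  fixedPoints≤q : ∀ {A} → A ≢ 0# → ∀ {ys} → Unique ys → All (λ y → A * φ y ≡ y) ys → length ys ≤ℕ Q
  fixedPoints≤q {A} A≢0 ys-unique ys-fixed =
    roots≤degree (+-lowerDegree (monomial A Q) (monomial 1# 1) 1<Q) A≢0 ys-unique (All.map root ys-fixed)
    where
    1<Q : 1 < Q
    1<Q = ℕ.*-monoʳ-≤ 2 (ℕ.m^n>0 2 n)
    root : ∀ {y} → A * φ y ≡ y → A * y ^ Q + 1# * y ^ 1 ≡ 0#
    root {y} fixed = trans (cong₂ _+_ fixed (trans (*-identityˡ _) (*-identityʳ y))) (x+x≡0 y)

  bivariate : (A B C D E u v : Carrier) → Carrier
  bivariate A B C D E u v = u * (A * u ^ 2 + B * v + C * v ^ 2) + u ^ 2 * (D * v + E * v ^ 2) + v ^ 3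

  f≡bivariate : ∀ A B C D E x → fABCDE (suc n) F A B C D E x ≡ bivariate A B C D E x (φ x)
  f≡bivariate A B C D E x = cong₂ (λ y z → x * (A * x ^ 2 + B * φ x + C * y) + x ^ 2 * (D * φ x + E * y) + z)
    (power-of-φ 2) (power-of-φ 3)
    where
    power-of-φ : ∀ k → x ^ (k *ℕ Q) ≡ φ x ^ k
    power-of-φ k = trans (cong (x ^_) (ℕ.*-comm k Q)) (sym (^-assocʳ x Q k))

  φ-bivariate : ∀ A B C D E u v →
    φ (bivariate A B C D E u v) ≡ bivariate (φ A) (φ B) (φ C) (φ D) (φ E) (φ u) (φ v)
  φ-bivariate A B C D E u v =
    trans (φ-+ _ _) (cong₂ _+_ (trans (φ-+ _ _) (cong₂ _+_ first second)) (φ-^ v 3))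
    where
    φ-monomial : ∀ a x k → φ (a * x ^ k) ≡ φ a * φ x ^ k
    φ-monomial a x k = trans (φ-* a (x ^ k)) (cong (φ a *_) (φ-^ x k))
    first : φ (u * (A * u ^ 2 + B * v + C * v ^ 2)) ≡ φ u * (φ A * φ u ^ 2 + φ B * φ v + φ C * φ v ^ 2)
    first = trans (φ-* _ _) (cong (φ u *_) (trans (φ-+ _ _)
      (cong₂ _+_ (trans (φ-+ _ _) (cong₂ _+_ (φ-monomial A u 2) (φ-* B v))) (φ-monomial C v 2))))
    second : φ (u ^ 2 * (D * v + E * v ^ 2)) ≡ φ u ^ 2 * (φ D * φ v + φ E * φ v ^ 2)
    second = trans (φ-* _ _) (cong₂ _*_ (φ-^ u 2) (trans (φ-+ _ _) (cong₂ _+_ (φ-* D v) (φ-monomial E v 2))))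

  bivariate-swap : ∀ {A Ā B C C̄ D E} u v → A * Ā ≡ 1# → A * C̄ ≡ D →
    A * bivariate Ā (Ā * B) C̄ (Ā * C) (Ā * E) v u ≡ bivariate A B C D E u v
  bivariate-swap {A} {Ā} {B} {C} {C̄} {D} {E} u v AĀ≡1 AC̄≡D = begin
    A * bivariate Ā (Ā * B) C̄ (Ā * C) (Ā * E) v u
      ≡⟨ solve 8 (λ A Ā B C C̄ E u v →
           A :* (v :* (Ā :* v :^ 2 :+ (Ā :* B) :* u :+ C̄ :* u :^ 2)
                 :+ v :^ 2 :* ((Ā :* C) :* u :+ (Ā :* E) :* u :^ 2) :+ u :^ 3)
           := (A :* Ā) :* (v :^ 3 :+ B :* (u :* v) :+ C :* (u :* v :^ 2) :+ E :* (u :^ 2 :* v :^ 2))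
              :+ (A :* C̄) :* (u :^ 2 :* v) :+ A :* u :^ 3)
         refl A Ā B C C̄ E u v ⟩
    (A * Ā) * G + (A * C̄) * (u ^ 2 * v) + A * u ^ 3
      ≡⟨ cong₂ (λ a d → a * G + d * (u ^ 2 * v) + A * u ^ 3) AĀ≡1 AC̄≡D ⟩
    1# * G + D * (u ^ 2 * v) + A * u ^ 3
      ≡⟨ cong (λ g → g + D * (u ^ 2 * v) + A * u ^ 3) (*-identityˡ G) ⟩
    G + D * (u ^ 2 * v) + A * u ^ 3
      ≡⟨ solve 7 (λ A B C D E u v →
           v :^ 3 :+ B :* (u :* v) :+ C :* (u :* v :^ 2) :+ E :* (u :^ 2 :* v :^ 2)
             :+ D :* (u :^ 2 :* v) :+ A :* u :^ 3
           := u :* (A :* u :^ 2 :+ B :* v :+ C :* v :^ 2) :+ u :^ 2 :* (D :* v :+ E :* v :^ 2) :+ v :^ 3)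
         refl A B C D E u v ⟩
    bivariate A B C D E u v ∎
    where
    open ≡-Reasoning
    G : Carrier
    G = v ^ 3 + B * (u * v) + C * (u * v ^ 2) + E * (u ^ 2 * v ^ 2)

  module _ {A B C D E : Carrier} (AĀ≡1 : A * φ A ≡ 1#) (D≡AC̄ : D ≡ A * φ C)
           (B̄≡ĀB : φ B ≡ φ A * B) (Ē≡ĀE : φ E ≡ φ A * E) where

    f : Carrier → Carrier
    f = fABCDE (suc n) F A B C D E

    twisted-φ-f : ∀ x → A * φ (f x) ≡ f x
    twisted-φ-f x = begin
      A * φ (f x)
        ≡⟨ cong (λ y → A * φ y) (f≡bivariate A B C D E x) ⟩
      A * φ (bivariate A B C D E x (φ x))
        ≡⟨ cong (A *_) (φ-bivariate A B C D E x (φ x)) ⟩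
      A * bivariate (φ A) (φ B) (φ C) (φ D) (φ E) (φ x) (φ (φ x))
        ≡⟨ cong₂ (λ b y → A * bivariate (φ A) b (φ C) (φ D) (φ E) (φ x) y) B̄≡ĀB (φ-involutive x) ⟩
      A * bivariate (φ A) (φ A * B) (φ C) (φ D) (φ E) (φ x) x
        ≡⟨ cong₂ (λ d e → A * bivariate (φ A) (φ A * B) (φ C) d e (φ x) x) D̄≡ĀC Ē≡ĀE ⟩
      A * bivariate (φ A) (φ A * B) (φ C) (φ A * C) (φ A * E) (φ x) x
        ≡⟨ bivariate-swap x (φ x) AĀ≡1 (sym D≡AC̄) ⟩
      bivariate A B C D E x (φ x)
        ≡⟨ f≡bivariate A B C D E x ⟨
      f x ∎
      where
      open ≡-Reasoning
      D̄≡ĀC : φ D ≡ φ A * C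
      D̄≡ĀC = trans (cong φ D≡AC̄) (trans (φ-* A (φ C)) (cong (φ A *_) (φ-involutive C)))

    twisted-φ-derivative : ∀ a x → A * φ (f (x + a) + f x) ≡ f (x + a) + f x
    twisted-φ-derivative a x = trans (cong (A *_) (φ-+ _ _))
      (trans (distribˡ A _ _) (cong₂ _+_ (twisted-φ-f (x + a)) (twisted-φ-f x)))

    not-APN : A ≢ 0# → 2 < Q → ¬ IsAPN (suc n) F f
    not-APN A≢0 2<Q apn = ℕ.<⇒≱ 2<Q (ℕ.*-cancelʳ-≤ Q 2 Q {{ℕ.m^n≢0 2 (suc n)}} q²≤2q)
      where
      fixed? : Decidable (λ y → A * φ y ≡ y)
      fixed? y = A * φ y ≟ y
      fixedPoints : List Carrier
      fixedPoints = filter fixed? elements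
      q²≤2q : Q *ℕ Q ≤ℕ 2 *ℕ Q
      q²≤2q = begin
        Q *ℕ Q                   ≡⟨ length-elements ⟨
        length elements          ≤⟨ length≤k*length-image _≟_ (APN⇒derivative-2-to-1 (suc n) F apn 1≢0)
                                      fixedPoints elements-unique
                                      (λ {x} _ → ∈-filter⁺ fixed? (∈-elements _) (twisted-φ-derivative 1# x)) ⟩
        2 *ℕ length fixedPoints  ≤⟨ ℕ.*-monoʳ-≤ 2 (fixedPoints≤q A≢0 (Unique.filter⁺ fixed? elements-unique)
                                      (all-filter fixed? elements)) ⟩
        2 *ℕ Q                   ∎
        where open ℕ.≤-Reasoning

proposition2p5 : ∃ λ (N : ℕ) → ∀ (n : ℕ) → n ≥ N → (F : GF-q² n) →
    let open FiniteField F in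
    ∀ (A B C D E : Carrier) →
    A * C * D ≢ 0# →
    A ^ (q n F +ℕ 1) ≡ 1# →
    D ≡ A * (C ^ q n F) →
    B ^ q n F ≡ (A ^ q n F) * B →
    E ^ q n F ≡ (A ^ q n F) * E →
    ¬ IsAPN n F (fABCDE n F A B C D E)
proposition2p5 = 2 , λ where
  zero ()
  (suc n) (s≤s 1≤n) F A B C D E ACD≢0 A^[q+1]≡1 D≡AC^q B^q≡A^qB E^q≡A^qE →
    let open FiniteField F
        open FiniteFieldProperties F
    in TwistedFrobenius.not-APN n F
         (subst (λ k → A ^ k ≡ 1#) (ℕ.+-comm (q (suc n) F) 1) A^[q+1]≡1)
         D≡AC^q B^q≡A^qB E^q≡A^qE
         (*-nonzero⁻ˡ (*-nonzero⁻ˡ ACD≢0))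
         (ℕ.≤-trans (ℕ.n≤1+n 3) (ℕ.^-monoʳ-≤ 2 (s≤s 1≤n)))
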